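{- For all $n\geq1$ and $l\geq k\geq 1$, $$Q_{n,k}(x,t)Q_{n,l}(x,t)-Q_{n,k-1}(x,t)Q_{n,l+1}(x,t)\in\mathbb R_+[x,t],$$ i.e. the sequence $\{Q_{n,k}(x,t)\}_{k=0}^{n-1}$ is strongly $\{x,t\}$-log-concave.
   Context: The generalized Ramanujan polynomials $Q_n(x,y,z,t)$ are defined by $Q_1=1$ and, for $n\geq1$, $Q_{n+1}=(x+nz)Q_n+(y+t)\left(nQ_n+y\,\frac{\partial Q_n}{\partial y}\right)$. Define $Q_{n,k}(x,t)$ by $Q_n(x,y,1,t)=\sum_{k=0}^{n-1}Q_{n,k}(x,t)y^k$, with $Q_{n,k}(x,t)=0$ for $k<0$ or $k\geq n$. $\mathbb R_+[x,t]$ denotes polynomials in $x,t$ with nonnegative real coefficients. -}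

module Defs where

open import Data.Nat using (ℕ; zero; suc; _∸_)
open import Data.Integer using (ℤ; +_; _+_; _-_; _*_; 0ℤ; 1ℤ; _≤_)

-- A polynomial in x, y, t (with z already specialised to 1) over ℤ,
-- represented by its coefficient function:  P k i j = [y^k x^i t^j] P.
Poly3 : Set
Poly3 = ℕ → ℕ → ℕ → ℤ

-- A polynomial in x, t over ℤ:  p i j = [x^i t^j] p.
Poly2 : Set
Poly2 = ℕ → ℕ → ℤ

one3 : Poly3
one3 zero zero zero = 1ℤ
one3 _    _    _    = 0ℤ

_⊕_ : Poly3 → Poly3 → Poly3
(P ⊕ R) k i j = P k i j + R k i j
infixl 6 _⊕_

_·_ : ℕ → Poly3 → Poly3
(c · P) k i j = + c * P k i j
infixl 7 _·_

mulX : Poly3 → Poly3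
mulX P k zero    j = 0ℤ
mulX P k (suc i) j = P k i j

mulY : Poly3 → Poly3
mulY P zero    i j = 0ℤ
mulY P (suc k) i j = P k i j

mulT : Poly3 → Poly3
mulT P k i zero    = 0ℤ
mulT P k i (suc j) = P k i j

yDy : Poly3 → Poly3
yDy P k i j = + k * P k i j

mulYT : Poly3 → Poly3
mulYT P = mulY P ⊕ mulT P

-- One step of the recurrence with z = 1:
--   Q_{n+1} = (x + n z) Q_n + (y + t) (n Q_n + y ∂Q_n/∂y)
step : ℕ → Poly3 → Poly3
step n P = (mulX P ⊕ n · P) ⊕ mulYT (n · P ⊕ yDy P)

-- Qs m = Q_{m+1}(x, y, 1, t)
Qs : ℕ → Poly3
Qs zero    = one3
Qs (suc m) = step (suc m) (Qs m)

-- Q n = Q_n(x, y, 1, t) for n ≥ 1 (Q 0 is an unused dummy value 0)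
Q : ℕ → Poly3
Q zero    = λ _ _ _ → 0ℤ
Q (suc m) = Qs m

-- Q_{n,k}(x,t) = [y^k] Q_n(x,y,1,t)  (k ≥ 0; it vanishes for k ≥ n by construction)
Qnk : ℕ → ℕ → Poly2
Qnk n k = Q n k

sumTo : ℕ → (ℕ → ℤ) → ℤ
sumTo zero    f = f zero
sumTo (suc i) f = sumTo i f + f (suc i)

_⊗_ : Poly2 → Poly2 → Poly2
(p ⊗ q) i j = sumTo i (λ a → sumTo j (λ b → p a b * q (i ∸ a) (j ∸ b)))
infixl 7 _⊗_

_⊖_ : Poly2 → Poly2 → Poly2
(p ⊖ q) i j = p i j - q i j
infixl 6 _⊖_

NonNeg : Poly2 → Set
NonNeg p = ∀ i j → 0ℤ ≤ p i j

-- Write Q_{n,k} for the coefficient of y^k in Q_n(x,y,1,t).  Extracting it from the recurrence gives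
--   Q_{n+1,k} = (x + n + (n+k) t) Q_{n,k} + (n+k-1) Q_{n,k-1},
-- and one proves by induction on n that all Q_{n,k} have nonnegative coefficients and that
-- Q_{n,k-1} Q_{n,l+1} ≤ Q_{n,k} Q_{n,l} coefficientwise whenever k ≤ l.  Expanding both products at
-- level n+1 by this recurrence, the quadratic, linear and constant parts of Q_{n+1,k-1} Q_{n+1,l+1}
-- are dominated by the corresponding parts of Q_{n+1,k} Q_{n+1,l}.  Since the coefficients of the
-- recurrence are linear in k with slope 1, shifting them between the two factors only creates the
-- nonnegative terms (l-k+1) t², 2(l-k+1) t and (l-k+1); what remains are instances of the induction
-- hypothesis (or of commutativity when k = l).  So no subtraction ever occurs: everything is
-- monotonicity of sums and products of polynomials with nonnegative coefficients.

module Submission where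

open import Defs

module Poly2Algebra where

  open import Data.Nat as ℕ using (ℕ; zero; suc; _∸_)
  import Data.Nat.Properties as ℕ
  open import Data.Integer using (ℤ; +_; 0ℤ; 1ℤ; _+_; _*_; _≤_; +≤+)
  open import Data.Integer.Properties
    using ( +-assoc; +-comm; +-identityˡ; +-identityʳ; *-assoc; *-comm
          ; *-distribˡ-+; *-distribʳ-+; +-mono-≤; *-monoˡ-≤-nonNeg; pos-*
          ; ≤-refl; ≤-reflexive; ≤-trans; i≤j⇒0≤j-i)
  open import Data.Integer.Tactic.RingSolver using (solve-∀; solve)
  open import Data.List using (_∷_; [])
  open import Relation.Binary.Bundles using (Preorder)
  import Relation.Binary.Reasoning.Preorder
  open import Relation.Binary.PropositionalEquality
    using (_≡_; refl; sym; trans; cong; cong₂; subst; module ≡-Reasoning)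

  infixl 6 _+ₚ_
  infixr 7 _•_
  infix 4 _≈ₚ_ _≤ₚ_

  0ₚ : Poly2
  0ₚ _ _ = 0ℤ

  _+ₚ_ : Poly2 → Poly2 → Poly2
  (p +ₚ q) i j = p i j + q i j

  _•_ : ℕ → Poly2 → Poly2
  (c • p) i j = + c * p i j

  mulXₚ mulTₚ : Poly2 → Poly2
  mulXₚ p zero    j = 0ℤ
  mulXₚ p (suc i) j = p i j
  mulTₚ p i zero    = 0ℤ
  mulTₚ p i (suc j) = p i j

  mulLinear : ℕ → ℕ → Poly2 → Poly2
  mulLinear c e p = mulXₚ p +ₚ c • p +ₚ e • mulTₚ p

  prev : (ℕ → Poly2) → ℕ → Poly2
  prev A zero    = 0ₚ
  prev A (suc k) = A k

  _≈ₚ_ _≤ₚ_ : Poly2 → Poly2 → Set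
  p ≈ₚ q = ∀ i j → p i j ≡ q i j
  p ≤ₚ q = ∀ i j → p i j ≤ q i j

  ≤ₚ-preorder : Preorder _ _ _
  ≤ₚ-preorder = record
    { Carrier    = Poly2
    ; _≈_        = _≈ₚ_
    ; _≲_        = _≤ₚ_
    ; isPreorder = record
      { isEquivalence = record
        { refl  = λ i j → refl
        ; sym   = λ p≈q i j → sym (p≈q i j)
        ; trans = λ p≈q q≈r i j → trans (p≈q i j) (q≈r i j)
        }
      ; reflexive = λ p≈q i j → ≤-reflexive (p≈q i j)
      ; trans     = λ p≤q q≤r i j → ≤-trans (p≤q i j) (q≤r i j)
      }
    }

  ≤ₚ-refl : ∀ {p} → p ≤ₚ p
  ≤ₚ-refl i j = ≤-refl

  module ≤ₚ-Reasoning = Relation.Binary.Reasoning.Preorder ≤ₚ-preorder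

  ≤ₚ⇒nonNeg-⊖ : ∀ {p q} → p ≤ₚ q → NonNeg (q ⊖ p)
  ≤ₚ⇒nonNeg-⊖ p≤q i j = i≤j⇒0≤j-i (p≤q i j)

  sumTo-cong : ∀ i {f g : ℕ → ℤ} → (∀ a → a ℕ.≤ i → f a ≡ g a) → sumTo i f ≡ sumTo i g
  sumTo-cong zero    f≗g = f≗g 0 ℕ.z≤n
  sumTo-cong (suc i) f≗g =
    cong₂ _+_ (sumTo-cong i (λ a a≤i → f≗g a (ℕ.m≤n⇒m≤1+n a≤i))) (f≗g (suc i) ℕ.≤-refl)

  sumTo-zero : ∀ i {f : ℕ → ℤ} → (∀ a → f a ≡ 0ℤ) → sumTo i f ≡ 0ℤ
  sumTo-zero zero    f≗0 = f≗0 0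
  sumTo-zero (suc i) f≗0 = cong₂ _+_ (sumTo-zero i f≗0) (f≗0 (suc i))

  sumTo-+ : ∀ i (f g : ℕ → ℤ) → sumTo i (λ a → f a + g a) ≡ sumTo i f + sumTo i g
  sumTo-+ zero    f g = refl
  sumTo-+ (suc i) f g = trans (cong (_+ (f (suc i) + g (suc i))) (sumTo-+ i f g))
                              (interchange (sumTo i f) (sumTo i g) (f (suc i)) (g (suc i)))
    where
    interchange : ∀ (a b c d : ℤ) → (a + b) + (c + d) ≡ (a + c) + (b + d)
    interchange = solve-∀

  sumTo-*ˡ : ∀ i (c : ℤ) (f : ℕ → ℤ) → sumTo i (λ a → c * f a) ≡ c * sumTo i f
  sumTo-*ˡ zero    c f = refl
  sumTo-*ˡ (suc i) c f = trans (cong (_+ c * f (suc i)) (sumTo-*ˡ i c f))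
                               (sym (*-distribˡ-+ c (sumTo i f) (f (suc i))))

  sumTo-suc : ∀ i (f : ℕ → ℤ) → sumTo (suc i) f ≡ f 0 + sumTo i (λ a → f (suc a))
  sumTo-suc zero    f = refl
  sumTo-suc (suc i) f = trans (cong (_+ f (suc (suc i))) (sumTo-suc i f)) (+-assoc (f 0) _ _)

  sumTo-tail : ∀ i (f : ℕ → ℤ) → f 0 ≡ 0ℤ → sumTo (suc i) f ≡ sumTo i (λ a → f (suc a))
  sumTo-tail i f f0≡0 =
    trans (sumTo-suc i f) (trans (cong (_+ sumTo i (λ a → f (suc a))) f0≡0) (+-identityˡ _))

  sumTo-reverse : ∀ i (f : ℕ → ℤ) → sumTo i f ≡ sumTo i (λ a → f (i ∸ a))
  sumTo-reverse zero    f = refl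
  sumTo-reverse (suc i) f = begin
    sumTo i f + f (suc i)                       ≡⟨ cong (_+ f (suc i)) (sumTo-reverse i f) ⟩
    sumTo i (λ a → f (i ∸ a)) + f (suc i)       ≡⟨ +-comm _ (f (suc i)) ⟩
    f (suc i) + sumTo i (λ a → f (i ∸ a))       ≡⟨ sumTo-suc i (λ a → f (suc i ∸ a)) ⟨
    sumTo (suc i) (λ a → f (suc i ∸ a))         ∎
    where open ≡-Reasoning

  sumTo-nonNeg : ∀ i {f : ℕ → ℤ} → (∀ a → 0ℤ ≤ f a) → 0ℤ ≤ sumTo i f
  sumTo-nonNeg zero    f≥0 = f≥0 0
  sumTo-nonNeg (suc i) f≥0 = +-mono-≤ (sumTo-nonNeg i f≥0) (f≥0 (suc i))

  +ₚ-cong : ∀ {p p' q q'} → p ≈ₚ p' → q ≈ₚ q' → p +ₚ q ≈ₚ p' +ₚ q'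
  +ₚ-cong p≈p' q≈q' i j = cong₂ _+_ (p≈p' i j) (q≈q' i j)

  •-cong : ∀ c {p q} → p ≈ₚ q → c • p ≈ₚ c • q
  •-cong c p≈q i j = cong (+ c *_) (p≈q i j)

  mulXₚ-cong : ∀ {p q} → p ≈ₚ q → mulXₚ p ≈ₚ mulXₚ q
  mulXₚ-cong p≈q zero    j = refl
  mulXₚ-cong p≈q (suc i) j = p≈q i j

  mulTₚ-cong : ∀ {p q} → p ≈ₚ q → mulTₚ p ≈ₚ mulTₚ q
  mulTₚ-cong p≈q i zero    = refl
  mulTₚ-cong p≈q i (suc j) = p≈q i j

  mulLinear-cong : ∀ c e {p q} → p ≈ₚ q → mulLinear c e p ≈ₚ mulLinear c e q
  mulLinear-cong c e p≈q = +ₚ-cong (+ₚ-cong (mulXₚ-cong p≈q) (•-cong c p≈q)) (•-cong e (mulTₚ-cong p≈q))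

  •-+ₚ : ∀ c p q → c • (p +ₚ q) ≈ₚ c • p +ₚ c • q
  •-+ₚ c p q i j = *-distribˡ-+ (+ c) (p i j) (q i j)

  ⊗-cong : ∀ {p p' q q'} → p ≈ₚ p' → q ≈ₚ q' → p ⊗ q ≈ₚ p' ⊗ q'
  ⊗-cong p≈p' q≈q' i j =
    sumTo-cong i (λ a _ → sumTo-cong j (λ b _ → cong₂ _*_ (p≈p' a b) (q≈q' (i ∸ a) (j ∸ b))))

  ⊗-comm : ∀ p q → p ⊗ q ≈ₚ q ⊗ p
  ⊗-comm p q i j =
    trans (sumTo-reverse i _) (sumTo-cong i (λ a a≤i →
      trans (sumTo-reverse j _) (sumTo-cong j (λ b b≤j → reflect-term a≤i b≤j))))
    where
    reflect-term : ∀ {a b} → a ℕ.≤ i → b ℕ.≤ j →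
      p (i ∸ a) (j ∸ b) * q (i ∸ (i ∸ a)) (j ∸ (j ∸ b)) ≡ q a b * p (i ∸ a) (j ∸ b)
    reflect-term {a} {b} a≤i b≤j =
      trans (*-comm (p (i ∸ a) (j ∸ b)) _)
            (cong₂ (λ a' b' → q a' b' * p (i ∸ a) (j ∸ b)) (ℕ.m∸[m∸n]≡n a≤i) (ℕ.m∸[m∸n]≡n b≤j))

  0ₚ-⊗ : ∀ q → 0ₚ ⊗ q ≈ₚ 0ₚ
  0ₚ-⊗ q i j = sumTo-zero i (λ _ → sumTo-zero j (λ _ → refl))

  +ₚ-⊗ : ∀ p q r → (p +ₚ q) ⊗ r ≈ₚ p ⊗ r +ₚ q ⊗ r
  +ₚ-⊗ p q r i j =
    trans (sumTo-cong i (λ a _ →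
            trans (sumTo-cong j (λ b _ → *-distribʳ-+ (r (i ∸ a) (j ∸ b)) (p a b) (q a b)))
                  (sumTo-+ j _ _)))
          (sumTo-+ i _ _)

  •-⊗ : ∀ c p q → (c • p) ⊗ q ≈ₚ c • (p ⊗ q)
  •-⊗ c p q i j =
    trans (sumTo-cong i (λ a _ →
            trans (sumTo-cong j (λ b _ → *-assoc (+ c) (p a b) (q (i ∸ a) (j ∸ b))))
                  (sumTo-*ˡ j (+ c) _)))
          (sumTo-*ˡ i (+ c) _)

  mulXₚ-⊗ : ∀ p q → mulXₚ p ⊗ q ≈ₚ mulXₚ (p ⊗ q)
  mulXₚ-⊗ p q zero    j = sumTo-zero j (λ _ → refl)
  mulXₚ-⊗ p q (suc i) j = sumTo-tail i _ (sumTo-zero j (λ _ → refl))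

  mulTₚ-⊗ : ∀ p q → mulTₚ p ⊗ q ≈ₚ mulTₚ (p ⊗ q)
  mulTₚ-⊗ p q i zero    = sumTo-zero i (λ _ → refl)
  mulTₚ-⊗ p q i (suc j) = sumTo-cong i (λ a _ → sumTo-tail j _ refl)

  mulLinear-⊗ : ∀ c e p q → mulLinear c e p ⊗ q ≈ₚ mulLinear c e (p ⊗ q)
  mulLinear-⊗ c e p q = begin-equality
    mulLinear c e p ⊗ q
      ≈⟨ +ₚ-⊗ (mulXₚ p +ₚ c • p) (e • mulTₚ p) q ⟩
    (mulXₚ p +ₚ c • p) ⊗ q +ₚ (e • mulTₚ p) ⊗ q
      ≈⟨ +ₚ-cong (+ₚ-⊗ (mulXₚ p) (c • p) q) (•-⊗ e (mulTₚ p) q) ⟩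
    mulXₚ p ⊗ q +ₚ (c • p) ⊗ q +ₚ e • (mulTₚ p ⊗ q)
      ≈⟨ +ₚ-cong (+ₚ-cong (mulXₚ-⊗ p q) (•-⊗ c p q)) (•-cong e (mulTₚ-⊗ p q)) ⟩
    mulLinear c e (p ⊗ q)
      ∎
    where open ≤ₚ-Reasoning

  ⊗-+ₚ : ∀ p q r → p ⊗ (q +ₚ r) ≈ₚ p ⊗ q +ₚ p ⊗ r
  ⊗-+ₚ p q r = begin-equality
    p ⊗ (q +ₚ r)     ≈⟨ ⊗-comm p (q +ₚ r) ⟩
    (q +ₚ r) ⊗ p     ≈⟨ +ₚ-⊗ q r p ⟩
    q ⊗ p +ₚ r ⊗ p   ≈⟨ +ₚ-cong (⊗-comm q p) (⊗-comm r p) ⟩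
    p ⊗ q +ₚ p ⊗ r   ∎
    where open ≤ₚ-Reasoning

  ⊗-• : ∀ c p q → p ⊗ (c • q) ≈ₚ c • (p ⊗ q)
  ⊗-• c p q = begin-equality
    p ⊗ (c • q)     ≈⟨ ⊗-comm p (c • q) ⟩
    (c • q) ⊗ p     ≈⟨ •-⊗ c q p ⟩
    c • (q ⊗ p)     ≈⟨ •-cong c (⊗-comm q p) ⟩
    c • (p ⊗ q)     ∎
    where open ≤ₚ-Reasoning

  ⊗-mulLinear : ∀ c e p q → p ⊗ mulLinear c e q ≈ₚ mulLinear c e (p ⊗ q)
  ⊗-mulLinear c e p q = begin-equality
    p ⊗ mulLinear c e q     ≈⟨ ⊗-comm p (mulLinear c e q) ⟩
    mulLinear c e q ⊗ p     ≈⟨ mulLinear-⊗ c e q p ⟩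
    mulLinear c e (q ⊗ p)   ≈⟨ mulLinear-cong c e (⊗-comm q p) ⟩
    mulLinear c e (p ⊗ q)   ∎
    where open ≤ₚ-Reasoning

  ⊗-expand : ∀ c e b p p' c' f g q q' →
    (mulLinear c e p +ₚ b • p') ⊗ (mulLinear c' f q +ₚ g • q')
      ≈ₚ mulLinear c e (mulLinear c' f (p ⊗ q))
         +ₚ (g • mulLinear c e (p ⊗ q') +ₚ b • mulLinear c' f (p' ⊗ q))
         +ₚ g • (b • (p' ⊗ q'))
  ⊗-expand c e b p p' c' f g q q' = begin-equality
    P ⊗ (Lq +ₚ g • q')
      ≈⟨ ⊗-+ₚ P Lq (g • q') ⟩
    P ⊗ Lq +ₚ P ⊗ (g • q')
      ≈⟨ +ₚ-cong (+ₚ-⊗ Lp (b • p') Lq) (⊗-• g P q') ⟩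
    Lp ⊗ Lq +ₚ (b • p') ⊗ Lq +ₚ g • (P ⊗ q')
      ≈⟨ +ₚ-cong (+ₚ-cong (mulLinear-⊗ c e p Lq) (•-⊗ b p' Lq)) (•-cong g (+ₚ-⊗ Lp (b • p') q')) ⟩
    mulLinear c e (p ⊗ Lq) +ₚ b • (p' ⊗ Lq) +ₚ g • (Lp ⊗ q' +ₚ (b • p') ⊗ q')
      ≈⟨ +ₚ-cong (+ₚ-cong (mulLinear-cong c e (⊗-mulLinear c' f p q)) (•-cong b (⊗-mulLinear c' f p' q)))
                 (•-cong g (+ₚ-cong (mulLinear-⊗ c e p q') (•-⊗ b p' q'))) ⟩
    U +ₚ V +ₚ g • (W +ₚ Z)
      ≈⟨ +ₚ-cong {U +ₚ V} (λ i j → refl) (•-+ₚ g W Z) ⟩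
    U +ₚ V +ₚ (g • W +ₚ g • Z)
      ≈⟨ (λ i j → regroup (U i j) (V i j) ((g • W) i j) ((g • Z) i j)) ⟩
    U +ₚ (g • W +ₚ V) +ₚ g • Z
      ∎
    where
    open ≤ₚ-Reasoning
    Lp Lq P U V W Z : Poly2
    Lp = mulLinear c e p
    Lq = mulLinear c' f q
    P  = Lp +ₚ b • p'
    U  = mulLinear c e (mulLinear c' f (p ⊗ q))
    V  = b • mulLinear c' f (p' ⊗ q)
    W  = mulLinear c e (p ⊗ q')
    Z  = b • (p' ⊗ q')
    regroup : ∀ (u v w z : ℤ) → (u + v) + (w + z) ≡ (u + (w + v)) + z
    regroup = solve-∀

  -- Products of linear forms in x and t.  The scalar identities are stated with 1ℤ + _ so that
  -- instantiating them at + n matches + suc n definitionally (+ m + + n reduces to + (m ℕ.+ n)).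

  mulTₚ-mulXₚ : ∀ p → mulTₚ (mulXₚ p) ≈ₚ mulXₚ (mulTₚ p)
  mulTₚ-mulXₚ p zero    zero    = refl
  mulTₚ-mulXₚ p zero    (suc j) = refl
  mulTₚ-mulXₚ p (suc i) zero    = refl
  mulTₚ-mulXₚ p (suc i) (suc j) = refl

  private
    zero-combination : ∀ (c e : ℤ) → 0ℤ ≡ 0ℤ + c * 0ℤ + e * 0ℤ
    zero-combination = solve-∀

  mulXₚ-mulLinear : ∀ c e p → mulXₚ (mulLinear c e p) ≈ₚ mulLinear c e (mulXₚ p)
  mulXₚ-mulLinear c e p zero    zero    = zero-combination (+ c) (+ e)
  mulXₚ-mulLinear c e p zero    (suc j) = zero-combination (+ c) (+ e)
  mulXₚ-mulLinear c e p (suc i) zero    = refl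
  mulXₚ-mulLinear c e p (suc i) (suc j) = refl

  mulTₚ-mulLinear : ∀ c e p → mulTₚ (mulLinear c e p) ≈ₚ mulLinear c e (mulTₚ p)
  mulTₚ-mulLinear c e p zero    zero    = zero-combination (+ c) (+ e)
  mulTₚ-mulLinear c e p (suc i) zero    = zero-combination (+ c) (+ e)
  mulTₚ-mulLinear c e p zero    (suc j) = refl
  mulTₚ-mulLinear c e p (suc i) (suc j) = refl

  mulLinear-mulLinear : ∀ c e c' f p i j →
    mulLinear c e (mulLinear c' f p) i j
      ≡ mulLinear c' f (mulXₚ p) i j + + c * mulLinear c' f p i j + + e * mulLinear c' f (mulTₚ p) i j
  mulLinear-mulLinear c e c' f p i j =
    cong₂ (λ u v → u + + c * mulLinear c' f p i j + + e * v)
          (mulXₚ-mulLinear c' f p i j) (mulTₚ-mulLinear c' f p i j)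

  mulLinear-exchange : ∀ c e f d p → f ≡ e ℕ.+ d →
    mulLinear c e (mulLinear c (suc (suc f)) p) +ₚ suc d • mulTₚ (mulTₚ p)
      ≈ₚ mulLinear c (suc e) (mulLinear c (suc f) p)
  mulLinear-exchange c e _ d p refl i j =
    trans (cong (_+ + suc d * mulTₚ (mulTₚ p) i j) (mulLinear-mulLinear c e c (suc (suc (e ℕ.+ d))) p i j))
      (trans (identity (+ c) (+ e) (+ d) (mulXₚ (mulXₚ p) i j) (mulXₚ p i j) (p i j)
                       (mulTₚ p i j) (mulTₚ (mulTₚ p) i j) (mulTₚ-mulXₚ p i j))
             (sym (mulLinear-mulLinear c (suc e) c (suc (e ℕ.+ d)) p i j)))
    where
    identity : ∀ (C E D xx x p₀ t tt : ℤ) {tx xt : ℤ} → tx ≡ xt →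
      (xx + C * x + (1ℤ + 1ℤ + E + D) * tx) + C * (x + C * p₀ + (1ℤ + 1ℤ + E + D) * t)
        + E * (xt + C * t + (1ℤ + 1ℤ + E + D) * tt) + (1ℤ + D) * tt
      ≡ (xx + C * x + (1ℤ + E + D) * tx) + C * (x + C * p₀ + (1ℤ + E + D) * t)
        + (1ℤ + E) * (xt + C * t + (1ℤ + E + D) * tt)
    identity C E D xx x p₀ t tt {tx} refl = solve (C ∷ E ∷ D ∷ xx ∷ x ∷ tx ∷ p₀ ∷ t ∷ tt ∷ [])

  mulLinear-balance : ∀ c e f b g d p → f ≡ e ℕ.+ d → g ≡ b ℕ.+ d →
    suc (suc g) • mulLinear c e p +ₚ b • mulLinear c (suc (suc f)) p +ₚ (suc d ℕ.+ suc d) • mulTₚ p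
      ≈ₚ suc g • mulLinear c (suc e) p +ₚ suc b • mulLinear c (suc f) p
  mulLinear-balance c e _ b _ d p refl refl i j =
    identity (+ c) (+ e) (+ b) (+ d) (mulXₚ p i j) (p i j) (mulTₚ p i j)
    where
    identity : ∀ (C E B D x p₀ t : ℤ) →
      (1ℤ + 1ℤ + B + D) * (x + C * p₀ + E * t) + B * (x + C * p₀ + (1ℤ + 1ℤ + E + D) * t)
        + ((1ℤ + D) + (1ℤ + D)) * t
      ≡ (1ℤ + B + D) * (x + C * p₀ + (1ℤ + E) * t) + (1ℤ + B) * (x + C * p₀ + (1ℤ + E + D) * t)
    identity = solve-∀

  •-exchange : ∀ b g d p → g ≡ b ℕ.+ d →
    suc (suc g) • (b • p) +ₚ suc d • p ≈ₚ suc g • (suc b • p)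
  •-exchange b _ d p refl i j = identity (+ b) (+ d) (p i j)
    where
    identity : ∀ (B D x : ℤ) →
      (1ℤ + 1ℤ + B + D) * (B * x) + (1ℤ + D) * x ≡ (1ℤ + B + D) * ((1ℤ + B) * x)
    identity = solve-∀

  nonNeg-* : ∀ {x y : ℤ} → 0ℤ ≤ x → 0ℤ ≤ y → 0ℤ ≤ x * y
  nonNeg-* {+ m} {+ n} _ _ = subst (0ℤ ≤_) (pos-* m n) (+≤+ ℕ.z≤n)

  +ₚ-mono : ∀ {p p' q q'} → p ≤ₚ p' → q ≤ₚ q' → p +ₚ q ≤ₚ p' +ₚ q'
  +ₚ-mono p≤p' q≤q' i j = +-mono-≤ (p≤p' i j) (q≤q' i j)

  •-mono : ∀ c {p q} → p ≤ₚ q → c • p ≤ₚ c • q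
  •-mono c {p} {q} p≤q i j = *-monoˡ-≤-nonNeg (+ c) {p i j} {q i j} (p≤q i j)

  mulXₚ-mono : ∀ {p q} → p ≤ₚ q → mulXₚ p ≤ₚ mulXₚ q
  mulXₚ-mono p≤q zero    j = ≤-refl
  mulXₚ-mono p≤q (suc i) j = p≤q i j

  mulTₚ-mono : ∀ {p q} → p ≤ₚ q → mulTₚ p ≤ₚ mulTₚ q
  mulTₚ-mono p≤q i zero    = ≤-refl
  mulTₚ-mono p≤q i (suc j) = p≤q i j

  mulLinear-mono : ∀ c e {p q} → p ≤ₚ q → mulLinear c e p ≤ₚ mulLinear c e q
  mulLinear-mono c e p≤q = +ₚ-mono (+ₚ-mono (mulXₚ-mono p≤q) (•-mono c p≤q)) (•-mono e (mulTₚ-mono p≤q))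

  ≤ₚ-+ₚʳ : ∀ p {q} → NonNeg q → p ≤ₚ p +ₚ q
  ≤ₚ-+ₚʳ p {q} q≥0 i j = subst (_≤ p i j + q i j) (+-identityʳ (p i j)) (+-mono-≤ (≤-refl {p i j}) (q≥0 i j))

  +ₚ-nonNeg : ∀ {p q} → NonNeg p → NonNeg q → NonNeg (p +ₚ q)
  +ₚ-nonNeg = +ₚ-mono

  •-nonNeg : ∀ c {p} → NonNeg p → NonNeg (c • p)
  •-nonNeg c p≥0 i j = nonNeg-* {+ c} (+≤+ ℕ.z≤n) (p≥0 i j)

  mulXₚ-nonNeg : ∀ {p} → NonNeg p → NonNeg (mulXₚ p)
  mulXₚ-nonNeg p≥0 zero    j = ≤-refl
  mulXₚ-nonNeg p≥0 (suc i) j = p≥0 i j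

  mulTₚ-nonNeg : ∀ {p} → NonNeg p → NonNeg (mulTₚ p)
  mulTₚ-nonNeg p≥0 i zero    = ≤-refl
  mulTₚ-nonNeg p≥0 i (suc j) = p≥0 i j

  mulLinear-nonNeg : ∀ c e {p} → NonNeg p → NonNeg (mulLinear c e p)
  mulLinear-nonNeg c e p≥0 =
    +ₚ-nonNeg (+ₚ-nonNeg (mulXₚ-nonNeg p≥0) (•-nonNeg c p≥0)) (•-nonNeg e (mulTₚ-nonNeg p≥0))

  ⊗-nonNeg : ∀ {p q} → NonNeg p → NonNeg q → NonNeg (p ⊗ q)
  ⊗-nonNeg p≥0 q≥0 i j =
    sumTo-nonNeg i (λ a → sumTo-nonNeg j (λ b → nonNeg-* (p≥0 a b) (q≥0 (i ∸ a) (j ∸ b))))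

module Recurrence where

  open import Data.Nat as ℕ using (ℕ; zero; suc)
  open import Data.Integer using (ℤ; +_; 0ℤ; 1ℤ; _+_; _*_; +≤+)
  open import Data.Integer.Properties using (+-assoc)
  open import Data.Integer.Tactic.RingSolver using (solve-∀)
  open import Relation.Binary.PropositionalEquality using (_≡_; refl; sym; trans; cong₂)
  open Poly2Algebra

  mulX≡mulXₚ : ∀ P k i j → mulX P k i j ≡ mulXₚ (P k) i j
  mulX≡mulXₚ P k zero    j = refl
  mulX≡mulXₚ P k (suc i) j = refl

  Qs-suc : ∀ m k → Qs (suc m) k ≈ₚ mulLinear (suc m) (k ℕ.+ suc m) (Qs m k) +ₚ (k ℕ.+ m) • prev (Qs m) k
  Qs-suc m k i j =
    trans (cong₂ (λ u v → u + + suc m * P k i j + v) (mulX≡mulXₚ P k i j) (y+t-part k j))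
          (sym (+-assoc (mulXₚ (P k) i j + + suc m * P k i j) (+ (k ℕ.+ suc m) * mulTₚ (P k) i j)
                        (+ (k ℕ.+ m) * prev P k i j)))
    where
    P : ℕ → Poly2
    P = Qs m
    y+t-part : ∀ k j →
      mulYT (suc m · P ⊕ yDy P) k i j ≡ + (k ℕ.+ suc m) * mulTₚ (P k) i j + + (k ℕ.+ m) * prev P k i j
    y+t-part zero    zero    = identity₁ (+ m)
      where
      identity₁ : ∀ (M : ℤ) → 0ℤ + 0ℤ ≡ (1ℤ + M) * 0ℤ + M * 0ℤ
      identity₁ = solve-∀
    y+t-part zero    (suc j) = identity₂ (+ m) (P 0 i j)
      where
      identity₂ : ∀ (M x : ℤ) → 0ℤ + ((1ℤ + M) * x + 0ℤ * x) ≡ (1ℤ + M) * x + M * 0ℤ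
      identity₂ = solve-∀
    y+t-part (suc k) zero    = identity₃ (+ m) (+ k) (P k i 0)
      where
      identity₃ : ∀ (M K x : ℤ) → ((1ℤ + M) * x + K * x) + 0ℤ ≡ (1ℤ + K + (1ℤ + M)) * 0ℤ + (1ℤ + K + M) * x
      identity₃ = solve-∀
    y+t-part (suc k) (suc j) = identity₄ (+ m) (+ k) (P k i (suc j)) (P (suc k) i j)
      where
      identity₄ : ∀ (M K x y : ℤ) →
        ((1ℤ + M) * x + K * x) + ((1ℤ + M) * y + (1ℤ + K) * y) ≡ (1ℤ + K + (1ℤ + M)) * y + (1ℤ + K + M) * x
      identity₄ = solve-∀

  Qs-zero-nonNeg : ∀ k → NonNeg (Qs 0 k)
  Qs-zero-nonNeg zero    zero    zero    = +≤+ ℕ.z≤n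
  Qs-zero-nonNeg zero    zero    (suc j) = +≤+ ℕ.z≤n
  Qs-zero-nonNeg zero    (suc i) j       = +≤+ ℕ.z≤n
  Qs-zero-nonNeg (suc k) i       j       = +≤+ ℕ.z≤n

open import Data.Nat using (ℕ; zero; suc; _≤_; _∸_; _+_; z≤n; s≤s)
open import Data.Nat.Properties
  using (+-comm; +-commutativeSemigroup; m≤m+n; m≤n⇒m≤1+n; m≤n⇒m<n∨m≡n; m≤n⇒∃[o]m+o≡n)
open import Algebra.Properties.CommutativeSemigroup +-commutativeSemigroup using (xy∙z≈xz∙y)
open import Data.Product using (_×_; _,_; proj₁; proj₂)
open import Data.Sum using (inj₁; inj₂)
open import Relation.Binary.PropositionalEquality using (_≡_; refl; sym)
open Poly2Algebra
open Recurrence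

NonNegSeq : (ℕ → Poly2) → Set
NonNegSeq A = ∀ k → NonNeg (A k)

StronglyLogConcave : (ℕ → Poly2) → Set
StronglyLogConcave A = ∀ k l → k ≤ l → prev A k ⊗ A (suc l) ≤ₚ A k ⊗ A l

infix 4 _≈ˢ_
_≈ˢ_ : (ℕ → Poly2) → (ℕ → Poly2) → Set
A ≈ˢ B = ∀ k → A k ≈ₚ B k

prev-cong : ∀ {A B} → A ≈ˢ B → prev A ≈ˢ prev B
prev-cong A≈B zero    i j = refl
prev-cong A≈B (suc k)     = A≈B k

prev-nonNeg : ∀ {A} → NonNegSeq A → NonNegSeq (prev A)
prev-nonNeg A≥0 zero    = ≤ₚ-refl
prev-nonNeg A≥0 (suc k) = A≥0 k

NonNegSeq-resp : ∀ {A B} → A ≈ˢ B → NonNegSeq A → NonNegSeq B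
NonNegSeq-resp {A} {B} A≈B A≥0 k = begin
  0ₚ   ≲⟨ A≥0 k ⟩
  A k  ≈⟨ A≈B k ⟩
  B k  ∎
  where open ≤ₚ-Reasoning

StronglyLogConcave-resp : ∀ {A B} → A ≈ˢ B → StronglyLogConcave A → StronglyLogConcave B
StronglyLogConcave-resp {A} {B} A≈B lcA k l k≤l = begin
  prev B k ⊗ B (suc l)  ≈⟨ ⊗-cong (prev-cong A≈B k) (A≈B (suc l)) ⟨
  prev A k ⊗ A (suc l)  ≲⟨ lcA k l k≤l ⟩
  A k ⊗ A l             ≈⟨ ⊗-cong (A≈B k) (A≈B l) ⟩
  B k ⊗ B l             ∎
  where open ≤ₚ-Reasoning

StronglyLogConcave-adjacent : ∀ {A} → StronglyLogConcave A →
  ∀ k l → k ≤ l → A k ⊗ A (suc l) ≤ₚ A (suc k) ⊗ A l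
StronglyLogConcave-adjacent {A} lcA k l k≤l with m≤n⇒m<n∨m≡n k≤l
... | inj₁ k<l  = lcA (suc k) l k<l
... | inj₂ refl = begin
  A k ⊗ A (suc k)  ≈⟨ ⊗-comm (A k) (A (suc k)) ⟩
  A (suc k) ⊗ A k  ∎
  where open ≤ₚ-Reasoning

-- Q_{n+1} is ramanujanStep n n (n ∸ 1) Q_n (see Qs-suc)
ramanujanStep : ℕ → ℕ → ℕ → (ℕ → Poly2) → ℕ → Poly2
ramanujanStep c a b A k = mulLinear c (k + a) (A k) +ₚ (k + b) • prev A k

ramanujanStep-nonNeg : ∀ c a b {A} → NonNegSeq A → NonNegSeq (ramanujanStep c a b A)
ramanujanStep-nonNeg c a b A≥0 k =
  +ₚ-nonNeg (mulLinear-nonNeg c (k + a) (A≥0 k)) (•-nonNeg (k + b) (prev-nonNeg A≥0 k))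

ramanujanStep-⊗ : ∀ c a b A k l →
  ramanujanStep c a b A k ⊗ ramanujanStep c a b A l
    ≈ₚ mulLinear c (k + a) (mulLinear c (l + a) (A k ⊗ A l))
       +ₚ ((l + b) • mulLinear c (k + a) (A k ⊗ prev A l) +ₚ (k + b) • mulLinear c (l + a) (prev A k ⊗ A l))
       +ₚ (l + b) • ((k + b) • (prev A k ⊗ prev A l))
ramanujanStep-⊗ c a b A k l =
  ⊗-expand c (k + a) (k + b) (A k) (prev A k) c (l + a) (l + b) (A l) (prev A l)

ramanujanStep-logConcave : ∀ c a b {A} → NonNegSeq A → StronglyLogConcave A →
  StronglyLogConcave (ramanujanStep c a b A)
ramanujanStep-logConcave c a b {A} A≥0 lcA zero l _ = begin
  0ₚ ⊗ B (suc l)  ≈⟨ 0ₚ-⊗ (B (suc l)) ⟩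
  0ₚ              ≲⟨ ⊗-nonNeg (B≥0 0) (B≥0 l) ⟩
  B 0 ⊗ B l       ∎
  where
  open ≤ₚ-Reasoning
  B : ℕ → Poly2
  B = ramanujanStep c a b A
  B≥0 : NonNegSeq B
  B≥0 = ramanujanStep-nonNeg c a b A≥0
ramanujanStep-logConcave c a b {A} A≥0 lcA (suc k) (suc l) (s≤s k≤l)
  with m≤n⇒∃[o]m+o≡n k≤l
... | d , refl = begin
  B k ⊗ B (suc (suc (k + d)))
    ≈⟨ ramanujanStep-⊗ c a b A k (suc (suc (k + d))) ⟩
  mulLinear c e (mulLinear c (suc (suc f)) PF)
    +ₚ (suc (suc g) • mulLinear c e PC +ₚ b' • mulLinear c (suc (suc f)) PG)
    +ₚ suc (suc g) • (b' • PH)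
    ≲⟨ +ₚ-mono (+ₚ-mono quadratic-terms linear-terms) constant-terms ⟩
  mulLinear c (suc e) (mulLinear c (suc f) PA)
    +ₚ (suc g • mulLinear c (suc e) PB +ₚ suc b' • mulLinear c (suc f) PC)
    +ₚ suc g • (suc b' • PE)
    ≈⟨ ramanujanStep-⊗ c a b A (suc k) (suc (k + d)) ⟨
  B (suc k) ⊗ B (suc (k + d))
    ∎
  where
  open ≤ₚ-Reasoning
  B : ℕ → Poly2
  B = ramanujanStep c a b A
  e f b' g : ℕ
  e = k + a
  f = l + a
  b' = k + b
  g = l + b
  f≡e+d : f ≡ e + d
  f≡e+d = xy∙z≈xz∙y k d a
  g≡b'+d : g ≡ b' + d
  g≡b'+d = xy∙z≈xz∙y k d b
  PA PB PC PE PF PG PH : Poly2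
  PA = A (suc k) ⊗ A (suc l)
  PB = A (suc k) ⊗ A l
  PC = A k ⊗ A (suc l)
  PE = A k ⊗ A l
  PF = A k ⊗ A (suc (suc l))
  PG = prev A k ⊗ A (suc (suc l))
  PH = prev A k ⊗ A (suc l)
  PC≥0 : NonNeg PC
  PC≥0 = ⊗-nonNeg (A≥0 k) (A≥0 (suc l))
  PF≥0 : NonNeg PF
  PF≥0 = ⊗-nonNeg (A≥0 k) (A≥0 (suc (suc l)))
  PH≥0 : NonNeg PH
  PH≥0 = ⊗-nonNeg (prev-nonNeg A≥0 k) (A≥0 (suc l))

  quadratic-terms : mulLinear c e (mulLinear c (suc (suc f)) PF)
                      ≤ₚ mulLinear c (suc e) (mulLinear c (suc f) PA)
  quadratic-terms = begin
    mulLinear c e (mulLinear c (suc (suc f)) PF)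
      ≲⟨ ≤ₚ-+ₚʳ _ (•-nonNeg (suc d) (mulTₚ-nonNeg (mulTₚ-nonNeg PF≥0))) ⟩
    mulLinear c e (mulLinear c (suc (suc f)) PF) +ₚ suc d • mulTₚ (mulTₚ PF)
      ≈⟨ mulLinear-exchange c e f d PF f≡e+d ⟩
    mulLinear c (suc e) (mulLinear c (suc f) PF)
      ≲⟨ mulLinear-mono c (suc e) (mulLinear-mono c (suc f) (lcA (suc k) (suc l) (s≤s (m≤m+n k d)))) ⟩
    mulLinear c (suc e) (mulLinear c (suc f) PA)
      ∎

  linear-terms : suc (suc g) • mulLinear c e PC +ₚ b' • mulLinear c (suc (suc f)) PG
                   ≤ₚ suc g • mulLinear c (suc e) PB +ₚ suc b' • mulLinear c (suc f) PC
  linear-terms = begin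
    suc (suc g) • mulLinear c e PC +ₚ b' • mulLinear c (suc (suc f)) PG
      ≲⟨ +ₚ-mono (≤ₚ-refl {suc (suc g) • mulLinear c e PC})
                 (•-mono b' (mulLinear-mono c (suc (suc f)) (lcA k (suc l) (m≤n⇒m≤1+n (m≤m+n k d))))) ⟩
    suc (suc g) • mulLinear c e PC +ₚ b' • mulLinear c (suc (suc f)) PC
      ≲⟨ ≤ₚ-+ₚʳ _ (•-nonNeg (suc d + suc d) (mulTₚ-nonNeg PC≥0)) ⟩
    suc (suc g) • mulLinear c e PC +ₚ b' • mulLinear c (suc (suc f)) PC +ₚ (suc d + suc d) • mulTₚ PC
      ≈⟨ mulLinear-balance c e f b' g d PC f≡e+d g≡b'+d ⟩
    suc g • mulLinear c (suc e) PC +ₚ suc b' • mulLinear c (suc f) PC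
      ≲⟨ +ₚ-mono (•-mono (suc g) (mulLinear-mono c (suc e) (StronglyLogConcave-adjacent lcA k l (m≤m+n k d))))
                 (≤ₚ-refl {suc b' • mulLinear c (suc f) PC}) ⟩
    suc g • mulLinear c (suc e) PB +ₚ suc b' • mulLinear c (suc f) PC
      ∎

  constant-terms : suc (suc g) • (b' • PH) ≤ₚ suc g • (suc b' • PE)
  constant-terms = begin
    suc (suc g) • (b' • PH)
      ≲⟨ ≤ₚ-+ₚʳ _ (•-nonNeg (suc d) PH≥0) ⟩
    suc (suc g) • (b' • PH) +ₚ suc d • PH
      ≈⟨ •-exchange b' g d PH g≡b'+d ⟩
    suc g • (suc b' • PH)
      ≲⟨ •-mono (suc g) (•-mono (suc b') (lcA k l (m≤m+n k d))) ⟩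
    suc g • (suc b' • PE)
      ∎

Qs-nonNeg-logConcave : ∀ m → NonNegSeq (Qs m) × StronglyLogConcave (Qs m)
Qs-nonNeg-logConcave zero = Qs-zero-nonNeg , Qs-zero-logConcave
  where
  open ≤ₚ-Reasoning
  Qs-zero-logConcave : StronglyLogConcave (Qs 0)
  Qs-zero-logConcave k l _ = begin
    prev (Qs 0) k ⊗ 0ₚ  ≈⟨ ⊗-comm (prev (Qs 0) k) 0ₚ ⟩
    0ₚ ⊗ prev (Qs 0) k  ≈⟨ 0ₚ-⊗ (prev (Qs 0) k) ⟩
    0ₚ                  ≲⟨ ⊗-nonNeg (Qs-zero-nonNeg k) (Qs-zero-nonNeg l) ⟩
    Qs 0 k ⊗ Qs 0 l     ∎
Qs-nonNeg-logConcave (suc m) =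
    NonNegSeq-resp step≈Qs (ramanujanStep-nonNeg (suc m) (suc m) m Qs≥0)
  , StronglyLogConcave-resp step≈Qs (ramanujanStep-logConcave (suc m) (suc m) m Qs≥0 lcQs)
  where
  Qs≥0 : NonNegSeq (Qs m)
  Qs≥0 = proj₁ (Qs-nonNeg-logConcave m)
  lcQs : StronglyLogConcave (Qs m)
  lcQs = proj₂ (Qs-nonNeg-logConcave m)
  step≈Qs : ramanujanStep (suc m) (suc m) m (Qs m) ≈ˢ Qs (suc m)
  step≈Qs k i j = sym (Qs-suc m k i j)

lemma4p3 : ∀ (n k l : ℕ) → 1 ≤ n → 1 ≤ k → k ≤ l →
    NonNeg (Qnk n k ⊗ Qnk n l ⊖ Qnk n (k ∸ 1) ⊗ Qnk n (l + 1))
lemma4p3 (suc m) (suc k) l (s≤s z≤n) (s≤s z≤n) k<l rewrite +-comm l 1 =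
  ≤ₚ⇒nonNeg-⊖ (proj₂ (Qs-nonNeg-logConcave m) (suc k) l k<l)
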